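{- Let $G$ be a finite simple graph with vertex set $V$, let $x\in V$, and let $X$ be the set of neighbours of $x$ in $G$, with $0<|X|<|V|$. Let $G_X$ be the graph obtained from $G$ by Seidel switching with respect to $X$. Then $x$ is an isolated vertex of $G_X$, and $\mbox{2-rank}(G_X)=\mbox{2-rank}(G)-2$ if $\mathbf{1}\in \mathrm{Col}_2(G)$, while $\mbox{2-rank}(G_X)=\mbox{2-rank}(G)$ otherwise.
   Context: The 2-rank of a graph is the rank over $\mathbb{F}_2$ of its adjacency matrix. For a graph $G$ with adjacency matrix $A$, $\mathrm{Col}_2(G)$ denotes the column space of $A$ over $\mathbb{F}_2$, and $\mathbf{1}$ is the all-ones vector. Seidel switching in $G=(V,E)$ with respect to a subset $X\subset V$ ($0<|X|<|V|$) deletes all edges of $G$ between $X$ and $V\setminus X$ and inserts all pairs $\{u,v\}$ with $u\in X$, $v\in V\setminus X$ that were not edges; edges with both ends inside $X$ or both outside $X$ are unchanged. -}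

module Defs where

open import Data.Nat using (ℕ; zero; suc; _+_)
open import Data.Fin using (Fin; zero; suc)
open import Data.Bool using (Bool; true; false; _xor_; _∧_; not; if_then_else_)
open import Data.Product using (Σ; _×_; ∃)
open import Relation.Binary.PropositionalEquality using (_≡_; _≢_)

-- Vectors over F₂ = Bool (xor is addition, ∧ is multiplication)
Vec₂ : ℕ → Set
Vec₂ n = Fin n → Bool

Mat₂ : ℕ → Set
Mat₂ n = Fin n → Fin n → Bool

sum₂ : ∀ {n} → (Fin n → Bool) → Bool
sum₂ {zero} f = false
sum₂ {suc n} f = f zero xor sum₂ {n} (λ i → f (suc i))

lincomb : ∀ {n r} → (Fin r → Vec₂ n) → (Fin r → Bool) → Vec₂ n
lincomb v c i = sum₂ (λ k → c k ∧ v k i)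

InSpan : ∀ {n r} → (Fin r → Vec₂ n) → Vec₂ n → Set
InSpan v w = ∃ λ c → ∀ i → lincomb v c i ≡ w i

LinIndep : ∀ {n r} → (Fin r → Vec₂ n) → Set
LinIndep v = ∀ c → (∀ i → lincomb v c i ≡ false) → ∀ k → c k ≡ false

col : ∀ {n} → Mat₂ n → Fin n → Vec₂ n
col A j i = A i j

InCol₂ : ∀ {n} → Mat₂ n → Vec₂ n → Set
InCol₂ A w = InSpan (col A) w

-- 2-rank: A has F₂-rank r iff some r columns of A form a basis of Col₂(A)
-- (linearly independent, and spanning every column of A).
Rank₂ : ∀ {n} → Mat₂ n → ℕ → Set
Rank₂ {n} A r = Σ (Fin r → Fin n) λ idx →
  LinIndep (λ k → col A (idx k)) × (∀ j → InSpan (λ k → col A (idx k)) (col A j))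

𝟏 : ∀ {n} → Vec₂ n
𝟏 _ = true

record Graph (n : ℕ) : Set where
  field
    adj   : Mat₂ n
    sym   : ∀ u v → adj u v ≡ adj v u
    irrefl : ∀ u → adj u u ≡ false
open Graph public

-- Seidel switching of adjacency matrix A w.r.t. subset X (characteristic function):
-- pairs with exactly one end in X are complemented, all others unchanged.
seidel : ∀ {n} → Mat₂ n → (Fin n → Bool) → Mat₂ n
seidel A X u v = if X u xor X v then not (A u v) else A u v

nbhd : ∀ {n} → Graph n → Fin n → (Fin n → Bool)
nbhd G x v = adj G x v

Isolated : ∀ {n} → Mat₂ n → Fin n → Set
Isolated A x = ∀ v → A x v ≡ false

-- Write a for the row of x, i.e. the characteristic vector of X, and A' for the switched
-- matrix. Then A'_uv = A_uv + a_u + a_v, so every column of A' is a column of A plus a plus a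
-- multiple of 𝟏, and conversely; moreover a is the column of A at x, and the row of x in A'
-- vanishes, so 𝟏 ∉ Col A'. If A w = 𝟏, then Σ w = wᵀ A w = 0 because A is symmetric with zero
-- diagonal; hence w is orthogonal to Col A' while w · a = 1, and Col A = Col A' ⊕ ⟨a, 𝟏⟩.
-- If 𝟏 ∉ Col A, duality gives z with A z = 0 and Σ z = 1; then A' z = a, and
-- Col A ⊕ ⟨𝟏⟩ = Col A' ⊕ ⟨𝟏⟩. Comparing dimensions uses the Steinitz exchange bound.
module Submission where

open import Defs
open import Data.Nat using (ℕ; _+_)
open import Data.Fin using (Fin)
open import Data.Bool using (true; false)
open import Data.Product using (Σ; _×_; ∃)
open import Relation.Nullary using (¬_)
open import Relation.Binary.PropositionalEquality using (_≡_)

open import Algebra.Bundles using (CommutativeRing; CommutativeMonoid)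
open import Data.Bool using (Bool; _xor_; _∧_; not; if_then_else_; _≟_)
open import Data.Bool.Properties
  using ( xor-∧-commutativeRing; ∧-commutativeMonoid; xor-assoc; xor-comm; xor-same
        ; xor-identityʳ; true-xor; ∧-assoc; ∧-comm; ∧-identityʳ; ∧-zeroʳ
        ; ∧-distribˡ-xor; ∧-distribʳ-xor; ¬-not )
open import Data.Empty using (⊥-elim)
open import Data.Fin using (zero; suc; punchIn) renaming (_≟_ to _≟ᶠ_)
open import Data.Fin.Properties using (any?; punchIn-punchOut)
open import Data.Nat using (zero; suc; _≤_; z≤n; s≤s)
open import Data.Nat.Properties using (≤-antisym; +-comm; suc-injective)
open import Data.Product using (_,_; proj₁; proj₂; ∃₂)
open import Data.Sum using (_⊎_; inj₁; inj₂; [_,_]′)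
open import Data.Vec.Functional using (_∷_; head; tail)
open import Function using (_∘_; const)
open import Relation.Nullary using (Dec; yes; no)
open import Relation.Binary.PropositionalEquality
  using (refl; cong; cong₂; subst; module ≡-Reasoning)
import Relation.Binary.PropositionalEquality as ≡

open CommutativeRing xor-∧-commutativeRing using (semiring)
open import Algebra.Properties.Semiring.Sum semiring
  using (sum; sum-cong-≗; ∑-distrib-+; ∑-comm; *-distribˡ-sum; *-distribʳ-sum)
open import Algebra.Properties.CommutativeSemigroup
  (CommutativeMonoid.commutativeSemigroup ∧-commutativeMonoid) using (x∙yz≈y∙xz)

open ≡-Reasoning

xor-cancelʳ : ∀ a b → (a xor b) xor b ≡ a
xor-cancelʳ a b = ≡.trans (xor-assoc a b b) (≡.trans (cong (a xor_) (xor-same b)) (xor-identityʳ a))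

xor-moveʳ : ∀ {a b} c → a ≡ b xor c → b ≡ a xor c
xor-moveʳ {b = b} c eq = ≡.trans (≡.sym (xor-cancelʳ b c)) (cong (_xor c) (≡.sym eq))

if-not≡xor : ∀ b a → (if b then not a else a) ≡ a xor b
if-not≡xor true  a = ≡.trans (≡.sym (true-xor a)) (xor-comm true a)
if-not≡xor false a = ≡.sym (xor-identityʳ a)

sum₂≡sum : ∀ {n} (f : Fin n → Bool) → sum₂ f ≡ sum f
sum₂≡sum {zero}  f = refl
sum₂≡sum {suc n} f = cong (f zero xor_) (sum₂≡sum (f ∘ suc))

sum₂-cong : ∀ {n} {f g : Fin n → Bool} → (∀ i → f i ≡ g i) → sum₂ f ≡ sum₂ g
sum₂-cong {f = f} {g} f≗g = begin
  sum₂ f  ≡⟨ sum₂≡sum f ⟩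
  sum f   ≡⟨ sum-cong-≗ f≗g ⟩
  sum g   ≡⟨ sum₂≡sum g ⟨
  sum₂ g  ∎

sum₂-zero : ∀ {n} {f : Fin n → Bool} → (∀ i → f i ≡ false) → sum₂ f ≡ false
sum₂-zero {zero}  _    = refl
sum₂-zero {suc n} f≡0 = cong₂ _xor_ (f≡0 zero) (sum₂-zero (f≡0 ∘ suc))

sum₂-xor : ∀ {n} (f g : Fin n → Bool) → sum₂ (λ i → f i xor g i) ≡ sum₂ f xor sum₂ g
sum₂-xor f g = begin
  sum₂ (λ i → f i xor g i)  ≡⟨ sum₂≡sum (λ i → f i xor g i) ⟩
  sum (λ i → f i xor g i)   ≡⟨ ∑-distrib-+ f g ⟩
  sum f xor sum g           ≡⟨ cong₂ _xor_ (sum₂≡sum f) (sum₂≡sum g) ⟨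
  sum₂ f xor sum₂ g         ∎

sum₂-∧ˡ : ∀ {n} b (f : Fin n → Bool) → sum₂ (λ i → b ∧ f i) ≡ b ∧ sum₂ f
sum₂-∧ˡ b f = begin
  sum₂ (λ i → b ∧ f i)  ≡⟨ sum₂≡sum (λ i → b ∧ f i) ⟩
  sum (λ i → b ∧ f i)   ≡⟨ *-distribˡ-sum b f ⟨
  b ∧ sum f             ≡⟨ cong (b ∧_) (sum₂≡sum f) ⟨
  b ∧ sum₂ f            ∎

sum₂-∧ʳ : ∀ {n} (f : Fin n → Bool) b → sum₂ (λ i → f i ∧ b) ≡ sum₂ f ∧ b
sum₂-∧ʳ f b = begin
  sum₂ (λ i → f i ∧ b)  ≡⟨ sum₂≡sum (λ i → f i ∧ b) ⟩
  sum (λ i → f i ∧ b)   ≡⟨ *-distribʳ-sum b f ⟨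
  sum f ∧ b             ≡⟨ cong (_∧ b) (sum₂≡sum f) ⟨
  sum₂ f ∧ b            ∎

sum₂-comm : ∀ {m n} (f : Fin m → Fin n → Bool) →
            sum₂ (λ i → sum₂ (f i)) ≡ sum₂ (λ j → sum₂ (λ i → f i j))
sum₂-comm f = begin
  sum₂ (λ i → sum₂ (f i))           ≡⟨ sum₂≡sum (λ i → sum₂ (f i)) ⟩
  sum (λ i → sum₂ (f i))            ≡⟨ sum-cong-≗ (λ i → sum₂≡sum (f i)) ⟩
  sum (λ i → sum (f i))             ≡⟨ ∑-comm f ⟩
  sum (λ j → sum (λ i → f i j))     ≡⟨ sum-cong-≗ (λ j → sum₂≡sum (λ i → f i j)) ⟨
  sum (λ j → sum₂ (λ i → f i j))    ≡⟨ sum₂≡sum (λ j → sum₂ (λ i → f i j)) ⟨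
  sum₂ (λ j → sum₂ (λ i → f i j))   ∎

infixl 6 _⊕_
infix  7 _·_

_⊕_ : ∀ {n} → Vec₂ n → Vec₂ n → Vec₂ n
(y ⊕ z) i = y i xor z i

-- lincomb v c i unfolds to c · (λ k → v k i); this is used silently throughout.
_·_ : ∀ {n} → Vec₂ n → Vec₂ n → Bool
y · z = sum₂ (λ i → y i ∧ z i)

·-comm : ∀ {n} (y z : Vec₂ n) → y · z ≡ z · y
·-comm y z = sum₂-cong (λ i → ∧-comm (y i) (z i))

·-distribˡ-⊕ : ∀ {n} (z y w : Vec₂ n) → z · (y ⊕ w) ≡ z · y xor z · w
·-distribˡ-⊕ z y w = ≡.trans (sum₂-cong (λ i → ∧-distribˡ-xor (z i) (y i) (w i)))
                              (sum₂-xor (λ i → z i ∧ y i) (λ i → z i ∧ w i))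

·-distribʳ-⊕ : ∀ {n} (y w z : Vec₂ n) → (y ⊕ w) · z ≡ y · z xor w · z
·-distribʳ-⊕ y w z = ≡.trans (sum₂-cong (λ i → ∧-distribʳ-xor (z i) (y i) (w i)))
                              (sum₂-xor (λ i → y i ∧ z i) (λ i → w i ∧ z i))

·-⊕-true : ∀ {n} (z y w : Vec₂ n) → z · (y ⊕ w) ≡ true → z · y ≡ not (z · w)
·-⊕-true z y w eq =
  ≡.trans (xor-moveʳ (z · w) (≡.sym (≡.trans (≡.sym (·-distribˡ-⊕ z y w)) eq))) (true-xor (z · w))

·-matrix-assoc : ∀ {p q} (c : Vec₂ p) (T : Fin p → Vec₂ q) (d : Vec₂ q) →
                 c · (λ k → T k · d) ≡ (λ j → c · (λ k → T k j)) · d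
·-matrix-assoc c T d = begin
  sum₂ (λ k → c k ∧ sum₂ (λ j → T k j ∧ d j))
    ≡⟨ sum₂-cong (λ k → sum₂-∧ˡ (c k) (λ j → T k j ∧ d j)) ⟨
  sum₂ (λ k → sum₂ (λ j → c k ∧ (T k j ∧ d j)))
    ≡⟨ sum₂-comm (λ k j → c k ∧ (T k j ∧ d j)) ⟩
  sum₂ (λ j → sum₂ (λ k → c k ∧ (T k j ∧ d j)))
    ≡⟨ sum₂-cong (λ j → sum₂-cong (λ k → ∧-assoc (c k) (T k j) (d j))) ⟨
  sum₂ (λ j → sum₂ (λ k → (c k ∧ T k j) ∧ d j))
    ≡⟨ sum₂-cong (λ j → sum₂-∧ʳ (λ k → c k ∧ T k j) (d j)) ⟩
  sum₂ (λ j → sum₂ (λ k → c k ∧ T k j) ∧ d j)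
    ∎

unit : ∀ {n} → Fin n → Vec₂ n
unit zero    = true ∷ const false
unit (suc i) = false ∷ unit i

unit-· : ∀ {n} (i : Fin n) (y : Vec₂ n) → unit i · y ≡ y i
unit-· zero    y = begin
  y zero xor sum₂ (λ i → false ∧ y (suc i))
    ≡⟨ cong (y zero xor_) (sum₂-zero {f = λ i → false ∧ y (suc i)} (λ _ → refl)) ⟩
  y zero xor false
    ≡⟨ xor-identityʳ (y zero) ⟩
  y zero
    ∎
unit-· (suc i) y = unit-· i (y ∘ suc)

·-lincomb : ∀ {n r} (z : Vec₂ n) (f : Fin r → Vec₂ n) (c : Vec₂ r) →
            z · lincomb f c ≡ (λ k → z · f k) · c
·-lincomb z f c = ≡.trans (sum₂-cong (λ i → cong (z i ∧_) (·-comm c (λ k → f k i))))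
                          (·-matrix-assoc z (λ i k → f k i) c)

lincomb-∘ : ∀ {n p q} {u : Fin p → Vec₂ n} {w : Fin q → Vec₂ n} (M : Fin p → Vec₂ q) →
            (∀ k i → lincomb w (M k) i ≡ u k i) → ∀ c i → lincomb u c i ≡ lincomb w (lincomb M c) i
lincomb-∘ {w = w} M M↦u c i =
  ≡.trans (sum₂-cong (λ k → cong (c k ∧_) (≡.sym (M↦u k i)))) (·-matrix-assoc c M (λ j → w j i))

_⊆Span_ : ∀ {n p q} → (Fin p → Vec₂ n) → (Fin q → Vec₂ n) → Set
u ⊆Span w = ∀ k → InSpan w (u k)

module _ {n r : ℕ} {f : Fin r → Vec₂ n} where

  InSpan-resp : ∀ {y z : Vec₂ n} → (∀ i → y i ≡ z i) → InSpan f y → InSpan f z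
  InSpan-resp y≗z (c , c↦y) = c , λ i → ≡.trans (c↦y i) (y≗z i)

  InSpan-⊕ : ∀ {y z : Vec₂ n} → InSpan f y → InSpan f z → InSpan f (y ⊕ z)
  InSpan-⊕ (c , c↦y) (d , d↦z) =
    c ⊕ d , λ i → ≡.trans (·-distribʳ-⊕ c d (λ k → f k i)) (cong₂ _xor_ (c↦y i) (d↦z i))

  InSpan-scale : ∀ {y : Vec₂ n} b → InSpan f y → InSpan f (λ i → b ∧ y i)
  InSpan-scale b (c , c↦y) = (λ k → b ∧ c k) , λ i →
    ≡.trans (sum₂-cong (λ k → ∧-assoc b (c k) (f k i)))
            (≡.trans (sum₂-∧ˡ b (λ k → c k ∧ f k i)) (cong (b ∧_) (c↦y i)))

  InSpan-tail : ∀ {v y : Vec₂ n} → InSpan f y → InSpan (v ∷ f) y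
  InSpan-tail (c , c↦y) = false ∷ c , c↦y

  InSpan-trans : ∀ {q} {w : Fin q → Vec₂ n} {y : Vec₂ n} → f ⊆Span w → InSpan f y → InSpan w y
  InSpan-trans f⊆w (c , c↦y) =
    lincomb M c , λ i → ≡.trans (≡.sym (lincomb-∘ M (proj₂ ∘ f⊆w) c i)) (c↦y i)
    where M = proj₁ ∘ f⊆w

  InSpan-vanishing : ∀ {i} {y : Vec₂ n} → (∀ k → f k i ≡ false) → InSpan f y → y i ≡ false
  InSpan-vanishing {i} f≡0 (c , c↦y) =
    ≡.trans (≡.sym (c↦y i)) (sum₂-zero (λ k → ≡.trans (cong (c k ∧_) (f≡0 k)) (∧-zeroʳ (c k))))

  vanishing⇒𝟏∉InSpan : ∀ {i} → (∀ k → f k i ≡ false) → ¬ InSpan f 𝟏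
  vanishing⇒𝟏∉InSpan f≡0 𝟏∈ with InSpan-vanishing f≡0 𝟏∈
  ... | ()

InSpan-member : ∀ {n r} (f : Fin r → Vec₂ n) j → InSpan f (f j)
InSpan-member f j = unit j , λ i → unit-· j (λ k → f k i)

InSpan-head : ∀ {n r} {f : Fin r → Vec₂ n} {v} → InSpan (v ∷ f) v
InSpan-head {f = f} {v} = InSpan-member (v ∷ f) zero

subfamily-⊆Span : ∀ {n m k} (f : Fin m → Vec₂ n) (idx : Fin k → Fin m) → (f ∘ idx) ⊆Span f
subfamily-⊆Span f idx k = InSpan-member f (idx k)

LinIndep-∷ : ∀ {n r} {f : Fin r → Vec₂ n} {v} → LinIndep f → ¬ InSpan f v → LinIndep (v ∷ f)
LinIndep-∷ {f = f} {v} f-indep v∉ c rel = λ where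
    zero    → head≡false
    (suc k) → f-indep (tail c) (rel-at head≡false) k
  where
  rel-at : ∀ {b} → c zero ≡ b → ∀ i → (b ∧ v i) xor lincomb f (tail c) i ≡ false
  rel-at c₀≡b i = ≡.trans (cong (λ t → (t ∧ v i) xor lincomb f (tail c) i) (≡.sym c₀≡b)) (rel i)
  head≡false : c zero ≡ false
  head≡false = ¬-not λ c₀≡1 →
    v∉ (tail c , λ i → ≡.sym (xor-moveʳ (lincomb f (tail c) i) (≡.sym (rel-at c₀≡1 i))))

_⊥_ : ∀ {n r} → Vec₂ n → (Fin r → Vec₂ n) → Set
z ⊥ f = ∀ k → z · f k ≡ false

Separated : ∀ {n r} → (Fin r → Vec₂ n) → Vec₂ n → Set
Separated f y = ∃ λ z → z ⊥ f × z · y ≡ true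

⊥-head-tail : ∀ {n r} {z : Vec₂ n} {f : Fin (suc r) → Vec₂ n} →
              z · head f ≡ false → z ⊥ tail f → z ⊥ f
⊥-head-tail z·f₀ _    zero    = z·f₀
⊥-head-tail _    z⊥f′ (suc k) = z⊥f′ k

Separated⇒∉InSpan : ∀ {n r} {f : Fin r → Vec₂ n} {y} → Separated f y → ¬ InSpan f y
Separated⇒∉InSpan {f = f} {y} (z , z⊥f , z·y) (c , c↦y) with
  ≡.trans (≡.sym z·y) (≡.trans (sum₂-cong (λ i → cong (z i ∧_) (≡.sym (c↦y i))))
    (≡.trans (·-lincomb z f c) (sum₂-zero (λ k → cong (_∧ c k) (z⊥f k)))))
... | ()

-- From z ⊥ f, z · y = 1 and z' ⊥ f, z' · (y + v) = 1, one of z, z', z + z' is also orthogonal to v.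
Separated-∷ : ∀ {n r} {f : Fin (suc r) → Vec₂ n} {y} →
              Separated (tail f) y → Separated (tail f) (y ⊕ head f) → Separated f y
Separated-∷ {f = f} {y} (z , z⊥ , z·y) (z' , z'⊥ , z'·y⊕f₀)
  with z · head f in z·f₀ | z' · head f in z'·f₀
... | false | _     = z , ⊥-head-tail {f = f} z·f₀ z⊥ , z·y
... | true  | false =
  z' , ⊥-head-tail {f = f} z'·f₀ z'⊥ ,
  ≡.trans (·-⊕-true z' y (head f) z'·y⊕f₀) (cong not z'·f₀)
... | true  | true  =
  z ⊕ z' ,
  ⊥-head-tail {f = f} (≡.trans (·-distribʳ-⊕ z z' (head f)) (cong₂ _xor_ z·f₀ z'·f₀))
      (λ k → ≡.trans (·-distribʳ-⊕ z z' (f (suc k))) (cong₂ _xor_ (z⊥ k) (z'⊥ k))) ,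
  ≡.trans (·-distribʳ-⊕ z z' y)
          (cong₂ _xor_ z·y (≡.trans (·-⊕-true z' y (head f) z'·y⊕f₀) (cong not z'·f₀)))

InSpan-or-Separated : ∀ {n r} (f : Fin r → Vec₂ n) y → InSpan f y ⊎ Separated f y
InSpan-or-Separated {r = zero} f y with any? (λ i → y i ≟ true)
... | yes (i , yᵢ≡1) = inj₂ (unit i , (λ ()) , ≡.trans (unit-· i y) yᵢ≡1)
... | no  ∄i        = inj₁ ((λ ()) , λ i → ≡.sym (¬-not (∄i ∘ (i ,_))))
InSpan-or-Separated {r = suc r} f y
  with InSpan-or-Separated (tail f) y | InSpan-or-Separated (tail f) (y ⊕ head f)
... | inj₁ y∈     | _         = inj₁ (InSpan-tail {f = tail f} y∈)
... | inj₂ _      | inj₁ y⊕f₀∈ =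
  inj₁ (InSpan-resp {f = f} (λ i → xor-cancelʳ (y i) (f zero i))
                   (InSpan-⊕ {f = f} (InSpan-tail {f = tail f} y⊕f₀∈) (InSpan-head {f = tail f})))
... | inj₂ y-sep  | inj₂ y⊕f₀-sep = inj₂ (Separated-∷ y-sep y⊕f₀-sep)

InSpan? : ∀ {n r} (f : Fin r → Vec₂ n) y → Dec (InSpan f y)
InSpan? f y = [ yes , no ∘ Separated⇒∉InSpan ]′ (InSpan-or-Separated f y)

IsBasisFor : ∀ {n m k} → (Fin m → Vec₂ n) → (Fin k → Fin m) → Set
IsBasisFor v idx = LinIndep (v ∘ idx) × v ⊆Span (v ∘ idx)

basis-exists : ∀ {n m} (v : Fin m → Vec₂ n) → ∃₂ λ k (idx : Fin k → Fin m) → IsBasisFor v idx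
basis-exists {m = zero}  v = 0 , (λ ()) , (λ _ _ ()) , (λ ())
basis-exists {m = suc m} v with basis-exists (tail v)
... | k , idx , indep , spans with InSpan? (tail v ∘ idx) (head v)
...   | yes v₀∈ = k , suc ∘ idx , indep , λ where
          zero    → v₀∈
          (suc j) → spans j
...   | no v₀∉  = suc k , zero ∷ suc ∘ idx , LinIndep-∷ indep v₀∉ , λ where
          zero    → InSpan-head
          (suc j) → InSpan-tail (spans j)

rank-exists : ∀ {n} (M : Mat₂ n) → ∃ (Rank₂ M)
rank-exists M = basis-exists (col M)

-- Gaussian elimination of coordinate i using the pivot vector u zero, which has u zero i = 1.
eliminate : ∀ {p q} → (Fin (suc p) → Vec₂ (suc q)) → Fin (suc q) → Fin p → Vec₂ q
eliminate u i k j = u (suc k) (punchIn i j) xor (u (suc k) i ∧ u zero (punchIn i j))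

module _ {p q} (u : Fin (suc p) → Vec₂ (suc q)) (i : Fin (suc q)) (d : Vec₂ p) where

  lifted : Vec₂ (suc p)
  lifted = lincomb (tail u) d i ∷ d

  lincomb-eliminate : ∀ j → lincomb (eliminate u i) d j ≡ lincomb u lifted (punchIn i j)
  lincomb-eliminate j = begin
    d · (λ k → u (suc k) t xor (u (suc k) i ∧ u zero t))
      ≡⟨ ·-distribˡ-⊕ d (λ k → u (suc k) t) (λ k → u (suc k) i ∧ u zero t) ⟩
    lincomb (tail u) d t xor d · (λ k → u (suc k) i ∧ u zero t)
      ≡⟨ cong (lincomb (tail u) d t xor_)
              (≡.trans (sum₂-cong (λ k → ≡.sym (∧-assoc (d k) (u (suc k) i) (u zero t))))
                       (sum₂-∧ʳ (λ k → d k ∧ u (suc k) i) (u zero t))) ⟩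
    lincomb (tail u) d t xor (c₀ ∧ u zero t)
      ≡⟨ xor-comm (lincomb (tail u) d t) (c₀ ∧ u zero t) ⟩
    (c₀ ∧ u zero t) xor lincomb (tail u) d t
      ∎
    where
    t  = punchIn i j
    c₀ = lincomb (tail u) d i

  lincomb-pivot : u zero i ≡ true → lincomb u lifted i ≡ false
  lincomb-pivot u₀ᵢ≡1 = begin
    (c₀ ∧ u zero i) xor c₀  ≡⟨ cong (λ t → (c₀ ∧ t) xor c₀) u₀ᵢ≡1 ⟩
    (c₀ ∧ true) xor c₀      ≡⟨ cong (_xor c₀) (∧-identityʳ c₀) ⟩
    c₀ xor c₀               ≡⟨ xor-same c₀ ⟩
    false                   ∎
    where c₀ = lincomb (tail u) d i

  lincomb-lifted : u zero i ≡ true → (∀ j → lincomb (eliminate u i) d j ≡ false) →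
                   ∀ t → lincomb u lifted t ≡ false
  lincomb-lifted u₀ᵢ≡1 rel t with i ≟ᶠ t
  ... | yes refl = lincomb-pivot u₀ᵢ≡1
  ... | no  i≢t  = begin
    lincomb u lifted t                           ≡⟨ cong (lincomb u lifted) (punchIn-punchOut i≢t) ⟨
    lincomb u lifted (punchIn i _)               ≡⟨ lincomb-eliminate _ ⟨
    lincomb (eliminate u i) d _                  ≡⟨ rel _ ⟩
    false                                        ∎

LinIndep-eliminate : ∀ {p q} (u : Fin (suc p) → Vec₂ (suc q)) i →
                     u zero i ≡ true → LinIndep u → LinIndep (eliminate u i)
LinIndep-eliminate u i u₀ᵢ≡1 u-indep d rel k =
  u-indep (lifted u i d) (lincomb-lifted u i d u₀ᵢ≡1 rel) (suc k)

LinIndep-head≢0 : ∀ {p q} (u : Fin (suc p) → Vec₂ q) → LinIndep u → ¬ (∀ i → u zero i ≡ false)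
LinIndep-head≢0 u u-indep u₀≡0
  with u-indep (unit zero) (λ i → ≡.trans (unit-· zero (λ k → u k i)) (u₀≡0 i)) zero
... | ()

LinIndep-≤ : ∀ {p q} (u : Fin p → Vec₂ q) → LinIndep u → p ≤ q
LinIndep-≤ {zero}          _ _       = z≤n
LinIndep-≤ {suc p} {zero}  u u-indep = ⊥-elim (LinIndep-head≢0 u u-indep (λ ()))
LinIndep-≤ {suc p} {suc q} u u-indep with any? (λ i → u zero i ≟ true)
... | yes (i , u₀ᵢ≡1) = s≤s (LinIndep-≤ (eliminate u i) (LinIndep-eliminate u i u₀ᵢ≡1 u-indep))
... | no  ∄i         = ⊥-elim (LinIndep-head≢0 u u-indep (λ i → ¬-not (∄i ∘ (i ,_))))

-- Steinitz: the coefficient vectors of u with respect to w are independent in 𝔽₂^q.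
LinIndep-⊆Span⇒≤ : ∀ {n p q} {u : Fin p → Vec₂ n} {w : Fin q → Vec₂ n} →
                   LinIndep u → u ⊆Span w → p ≤ q
LinIndep-⊆Span⇒≤ {u = u} {w} u-indep u⊆w = LinIndep-≤ M M-indep
  where
  M = proj₁ ∘ u⊆w
  M-indep : LinIndep M
  M-indep c Mc≡0 = u-indep c λ i →
    ≡.trans (lincomb-∘ M (proj₂ ∘ u⊆w) c i) (sum₂-zero (λ j → cong (_∧ w j i) (Mc≡0 j)))

LinIndep-same-span⇒≡ : ∀ {n p q} {u : Fin p → Vec₂ n} {w : Fin q → Vec₂ n} →
                       LinIndep u → LinIndep w → u ⊆Span w → w ⊆Span u → p ≡ q
LinIndep-same-span⇒≡ u-indep w-indep u⊆w w⊆u =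
  ≤-antisym (LinIndep-⊆Span⇒≤ u-indep u⊆w) (LinIndep-⊆Span⇒≤ w-indep w⊆u)

Symmetric : ∀ {n} → Mat₂ n → Set
Symmetric M = ∀ u v → M u v ≡ M v u

Hollow : ∀ {n} → Mat₂ n → Set
Hollow M = ∀ u → M u u ≡ false

-- The entries off the diagonal cancel in pairs.
sum-entries-symmetric-hollow : ∀ {n} (M : Mat₂ n) → Symmetric M → Hollow M →
                               sum₂ (λ u → sum₂ (M u)) ≡ false
sum-entries-symmetric-hollow {zero}  _ _     _        = refl
sum-entries-symmetric-hollow {suc n} M M-sym M-hollow = begin
  (M zero zero xor R) xor sum₂ (λ u → M (suc u) zero xor sum₂ (λ v → M (suc u) (suc v)))
    ≡⟨ cong₂ _xor_ (cong (_xor R) (M-hollow zero))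
                   (sum₂-xor (λ u → M (suc u) zero) (λ u → sum₂ (λ v → M (suc u) (suc v)))) ⟩
  R xor (sum₂ (λ u → M (suc u) zero) xor sum₂ (λ u → sum₂ (λ v → M (suc u) (suc v))))
    ≡⟨ cong (R xor_) (cong₂ _xor_ (sum₂-cong (λ u → M-sym (suc u) zero))
                                  (sum-entries-symmetric-hollow (λ u v → M (suc u) (suc v))
                                     (λ u v → M-sym (suc u) (suc v)) (M-hollow ∘ suc))) ⟩
  R xor (R xor false)
    ≡⟨ cong (R xor_) (xor-identityʳ R) ⟩
  R xor R
    ≡⟨ xor-same R ⟩
  false
    ∎
  where R = sum₂ (λ v → M zero (suc v))

quadratic-form-symmetric-hollow : ∀ {n} {M : Mat₂ n} → Symmetric M → Hollow M →
                                  ∀ w → w · lincomb (col M) w ≡ false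
quadratic-form-symmetric-hollow {M = M} M-sym M-hollow w =
  ≡.trans (sum₂-cong (λ u → ≡.sym (sum₂-∧ˡ (w u) (λ v → w v ∧ M u v))))
          (sum-entries-symmetric-hollow (λ u v → w u ∧ (w v ∧ M u v)) T-sym T-hollow)
  where
  T-sym : Symmetric (λ u v → w u ∧ (w v ∧ M u v))
  T-sym u v = ≡.trans (x∙yz≈y∙xz (w u) (w v) (M u v)) (cong (λ t → w v ∧ (w u ∧ t)) (M-sym u v))
  T-hollow : Hollow (λ u v → w u ∧ (w v ∧ M u v))
  T-hollow u = ≡.trans (cong (λ t → w u ∧ (w u ∧ t)) (M-hollow u))
                       (≡.trans (cong (w u ∧_) (∧-zeroʳ (w u))) (∧-zeroʳ (w u)))

·-col-symmetric : ∀ {n} {M : Mat₂ n} → Symmetric M → ∀ z v → z · col M v ≡ lincomb (col M) z v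
·-col-symmetric M-sym z v = sum₂-cong (λ u → cong (z u ∧_) (M-sym u v))

SwitchedBy : ∀ {n} → Vec₂ n → Mat₂ n → Mat₂ n → Set
SwitchedBy a M N = ∀ u v → N u v ≡ M u v xor (a u xor a v)

seidel-switchedBy : ∀ {n} (A : Mat₂ n) X → SwitchedBy X A (seidel A X)
seidel-switchedBy A X u v = if-not≡xor (X u xor X v) (A u v)

switchedBy-sym : ∀ {n} {a : Vec₂ n} {M N : Mat₂ n} → SwitchedBy a M N → SwitchedBy a N M
switchedBy-sym {a = a} switched u v = xor-moveʳ (a u xor a v) (switched u v)

module Switching {n} (a : Vec₂ n) (M N : Mat₂ n) (switched : SwitchedBy a M N) where

  switchedBy-symmetric : Symmetric M → Symmetric N
  switchedBy-symmetric M-sym u v = begin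
    N u v                      ≡⟨ switched u v ⟩
    M u v xor (a u xor a v)    ≡⟨ cong₂ _xor_ (M-sym u v) (xor-comm (a u) (a v)) ⟩
    M v u xor (a v xor a u)    ≡⟨ switched v u ⟨
    N v u                      ∎

  switchedBy-⊆Span : ∀ {r} {f : Fin r → Vec₂ n} →
                     col M ⊆Span f → InSpan f a → InSpan f 𝟏 → col N ⊆Span f
  switchedBy-⊆Span {f = f} M⊆f a∈f 𝟏∈f v =
    InSpan-resp {f = f} col-N (InSpan-⊕ (M⊆f v) (InSpan-⊕ a∈f (InSpan-scale (a v) 𝟏∈f)))
    where
    col-N : ∀ u → M u v xor (a u xor (a v ∧ true)) ≡ N u v
    col-N u = ≡.trans (cong (λ t → M u v xor (a u xor t)) (∧-identityʳ (a v)))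
                      (≡.sym (switched u v))

  lincomb-switchedBy : ∀ c u →
    lincomb (col N) c u ≡ lincomb (col M) c u xor ((sum₂ c ∧ a u) xor c · a)
  lincomb-switchedBy c u = begin
    c · N u
      ≡⟨ sum₂-cong (λ v → cong (c v ∧_) (switched u v)) ⟩
    c · (M u ⊕ (const (a u) ⊕ a))
      ≡⟨ ·-distribˡ-⊕ c (M u) (const (a u) ⊕ a) ⟩
    c · M u xor c · (const (a u) ⊕ a)
      ≡⟨ cong (c · M u xor_) (·-distribˡ-⊕ c (const (a u)) a) ⟩
    c · M u xor (c · const (a u) xor c · a)
      ≡⟨ cong (λ t → c · M u xor (t xor c · a)) (sum₂-∧ʳ c (a u)) ⟩
    c · M u xor ((sum₂ c ∧ a u) xor c · a)
      ∎

module _ {n} (G : Graph n) (x : Fin n) where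

  private
    A : Mat₂ n
    A = adj G
    a : Vec₂ n
    a = nbhd G x
    A' : Mat₂ n
    A' = seidel A a
    switched : SwitchedBy a A A'
    switched = seidel-switchedBy A a
    module Forward  = Switching a A A' switched
    module Backward = Switching a A' A (switchedBy-sym {a = a} switched)

  seidel-nbhd-isolated : Isolated A' x
  seidel-nbhd-isolated v = begin
    A' x v                     ≡⟨ switched x v ⟩
    A x v xor (A x x xor a v)  ≡⟨ cong (λ t → A x v xor (t xor a v)) (irrefl G x) ⟩
    A x v xor A x v            ≡⟨ xor-same (A x v) ⟩
    false                      ∎

  nbhd-∈InSpan : ∀ {r} {f : Fin r → Vec₂ n} → col A ⊆Span f → InSpan f a
  nbhd-∈InSpan {f = f} A⊆f = InSpan-resp {f = f} (λ u → sym G u x) (A⊆f x)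

  nbhd-∉Col-seidel : InCol₂ A 𝟏 → ¬ InCol₂ A' a
  nbhd-∉Col-seidel (w , Aw≡𝟏) = Separated⇒∉InSpan (w , w⊥A' , Aw≡𝟏 x)
    where
    Σw≡0 : sum₂ w ≡ false
    Σw≡0 = begin
      sum₂ w                 ≡⟨ sum₂-cong (λ u → ∧-identityʳ (w u)) ⟨
      w · 𝟏                  ≡⟨ sum₂-cong (λ u → cong (w u ∧_) (Aw≡𝟏 u)) ⟨
      w · lincomb (col A) w  ≡⟨ quadratic-form-symmetric-hollow (sym G) (irrefl G) w ⟩
      false                  ∎
    w⊥A' : w ⊥ col A'
    w⊥A' v = begin
      w · col A' v
        ≡⟨ ·-col-symmetric (Forward.switchedBy-symmetric (sym G)) w v ⟩
      lincomb (col A') w v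
        ≡⟨ Forward.lincomb-switchedBy w v ⟩
      lincomb (col A) w v xor ((sum₂ w ∧ a v) xor w · a)
        ≡⟨ cong₂ _xor_ (Aw≡𝟏 v) (cong₂ _xor_ (cong (_∧ a v) Σw≡0) (Aw≡𝟏 x)) ⟩
      true xor (false xor true)
        ∎

  Separated-𝟏⇒nbhd∈Col-seidel : Separated (col A) 𝟏 → InCol₂ A' a
  Separated-𝟏⇒nbhd∈Col-seidel (z , z⊥A , z·𝟏) = z , λ u → begin
    lincomb (col A') z u
      ≡⟨ Forward.lincomb-switchedBy z u ⟩
    lincomb (col A) z u xor ((sum₂ z ∧ a u) xor z · a)
      ≡⟨ cong₂ _xor_ (Az≡0 u) (cong₂ _xor_ (cong (_∧ a u) Σz≡1) (Az≡0 x)) ⟩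
    false xor ((true ∧ a u) xor false)
      ≡⟨ xor-identityʳ (a u) ⟩
    a u
      ∎
    where
    Az≡0 : ∀ u → lincomb (col A) z u ≡ false
    Az≡0 u = ≡.trans (≡.sym (·-col-symmetric (sym G) z u)) (z⊥A u)
    Σz≡1 : sum₂ z ≡ true
    Σz≡1 = ≡.trans (sum₂-cong (λ u → ≡.sym (∧-identityʳ (z u)))) z·𝟏

  rank-seidel-drop : InCol₂ A 𝟏 → ∀ {r s} → Rank₂ A r → Rank₂ A' s → r ≡ s + 2
  rank-seidel-drop 𝟏∈ {r} {s} (idx , B-indep , A⊆B) (idx' , B'-indep , A'⊆B') =
    ≡.trans (≡.sym (LinIndep-same-span⇒≡ F-indep B-indep F⊆B B⊆F)) (+-comm 2 s)
    where
    B  = col A ∘ idx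
    B' = col A' ∘ idx'
    aB' = a ∷ B'
    F  = 𝟏 ∷ aB'
    a∈B : InSpan B a
    a∈B = nbhd-∈InSpan A⊆B
    𝟏∈B : InSpan B 𝟏
    𝟏∈B = InSpan-trans {f = col A} A⊆B 𝟏∈
    F⊆B : F ⊆Span B
    F⊆B zero          = 𝟏∈B
    F⊆B (suc zero)    = a∈B
    F⊆B (suc (suc k)) = Forward.switchedBy-⊆Span {f = B} A⊆B a∈B 𝟏∈B (idx' k)
    B⊆F : B ⊆Span F
    B⊆F k = Backward.switchedBy-⊆Span {f = F}
              (λ v → InSpan-tail {f = aB'} (InSpan-tail {f = B'} (A'⊆B' v)))
              (InSpan-tail {f = aB'} (InSpan-head {f = B'}))
              (InSpan-head {f = aB'})
              (idx k)
    a∉B' : ¬ InSpan B' a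
    a∉B' = nbhd-∉Col-seidel 𝟏∈ ∘ InSpan-trans {f = B'} (subfamily-⊆Span (col A') idx')
    F-indep : LinIndep F
    F-indep = LinIndep-∷ {f = aB'} (LinIndep-∷ {f = B'} B'-indep a∉B')
      (vanishing⇒𝟏∉InSpan {f = aB'} {i = x} λ where
        zero    → irrefl G x
        (suc k) → seidel-nbhd-isolated (idx' k))

  rank-seidel-same : ¬ InCol₂ A 𝟏 → ∀ {r s} → Rank₂ A r → Rank₂ A' s → r ≡ s
  rank-seidel-same 𝟏∉ (idx , B-indep , A⊆B) (idx' , B'-indep , A'⊆B') =
    suc-injective (LinIndep-same-span⇒≡ E-indep F-indep E⊆F F⊆E)
    where
    B  = col A ∘ idx
    B' = col A' ∘ idx'
    E  = 𝟏 ∷ B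
    F  = 𝟏 ∷ B'
    a∈B' : InSpan B' a
    a∈B' = InSpan-trans {f = col A'} A'⊆B'
             ([ ⊥-elim ∘ 𝟏∉ , Separated-𝟏⇒nbhd∈Col-seidel ]′ (InSpan-or-Separated (col A) 𝟏))
    E⊆F : E ⊆Span F
    E⊆F zero    = InSpan-head {f = B'}
    E⊆F (suc k) = Backward.switchedBy-⊆Span {f = F}
                    (InSpan-tail {f = B'} ∘ A'⊆B') (InSpan-tail {f = B'} a∈B') (InSpan-head {f = B'})
                    (idx k)
    F⊆E : F ⊆Span E
    F⊆E zero    = InSpan-head {f = B}
    F⊆E (suc k) = Forward.switchedBy-⊆Span {f = E}
                    (InSpan-tail {f = B} ∘ A⊆B) (InSpan-tail {f = B} (nbhd-∈InSpan A⊆B)) (InSpan-head {f = B})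
                    (idx' k)
    E-indep : LinIndep E
    E-indep = LinIndep-∷ {f = B} B-indep (𝟏∉ ∘ InSpan-trans {f = B} (subfamily-⊆Span (col A) idx))
    F-indep : LinIndep F
    F-indep = LinIndep-∷ {f = B'} B'-indep
                (vanishing⇒𝟏∉InSpan {f = B'} {i = x} (seidel-nbhd-isolated ∘ idx'))

lemma2p1 : ∀ {n} (G : Graph n) (x : Fin n) →
    (∃ λ v → nbhd G x v ≡ true) →
    (∃ λ v → nbhd G x v ≡ false) →
    Isolated (seidel (adj G) (nbhd G x)) x
    × (∀ r → Rank₂ (adj G) r →
         (InCol₂ (adj G) 𝟏 → Σ ℕ λ s → (r ≡ s + 2) × Rank₂ (seidel (adj G) (nbhd G x)) s)
         × (¬ InCol₂ (adj G) 𝟏 → Rank₂ (seidel (adj G) (nbhd G x)) r))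
lemma2p1 G x _ _ = seidel-nbhd-isolated G x , λ r rank-A →
    (λ 𝟏∈ → s , rank-seidel-drop G x 𝟏∈ rank-A rank-A' , rank-A')
  , (λ 𝟏∉ → subst (Rank₂ A') (≡.sym (rank-seidel-same G x 𝟏∉ rank-A rank-A')) rank-A')
  where
  A' = seidel (adj G) (nbhd G x)
  s = proj₁ (rank-exists A')
  rank-A' = proj₂ (rank-exists A')
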